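{- The map $\psi$ is injective: if two saturated chains $\emptyset=Y_0\gtrdot Y_1\gtrdot\cdots\gtrdot Y_l$ and $\emptyset=Y'_0\gtrdot Y'_1\gtrdot\cdots\gtrdot Y'_{l'}$ of Young diagrams have $\psi$ of the first equal to $\psi$ of the second, then $l=l'$ and $Y_r=Y'_r$ for all $r$.
   Context: Young diagrams use English notation: rows indexed $1,2,\dots$ top to bottom, columns left to right, row lengths $\lambda_1\ge\lambda_2\ge\cdots$, $\lambda_j=0$ beyond the last row, $\lambda_0=+\infty$; $[m]=\{1,\dots,m\}$. For $d\ge1$, $h_Y(d)=\min\{h\ge1:\lambda_{d-h}\ge\lambda_d+h\}$ (height of the prime path of row $d$). If $B$ is the last box of row $x_B$, the $B$-strip is the set of last boxes of rows $x_B-h_Y(x_B)+1,\dots,x_B$; $B$ is a corner box if it is also lowest in its column. $Y'\gtrdot Y$ ($Y'$ covers $Y$) if $Y'$ is $Y$ with the $B$-strip of some corner box $B$ deleted; a saturated chain is a sequence $Y_0\gtrdot Y_1\gtrdot\cdots\gtrdot Y_l$. A tableau fills a Young diagram with positive integers, rows strictly increasing, columns weakly increasing downward, label set exactly $[l]$. For a saturated chain $\emptyset=Y_0\gtrdot Y_1\gtrdot\cdots\gtrdot Y_l$, $\psi$ of the chain is the tableau of shape $Y_l$ in which each box of $Y_r\setminus Y_{r-1}$ is labelled $r$, $r\in[l]$. -}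

module Defs where

open import Data.Nat using (ℕ; zero; suc; _+_; _∸_; _≤_; _<_; _≤ᵇ_; pred)
open import Data.Bool using (Bool; true; false; if_then_else_; _∧_; T)
open import Data.List using (List; []; _∷_; map; applyUpTo; length)
open import Data.List.Relation.Unary.All using (All)
open import Data.List.Relation.Unary.Linked using (Linked)
open import Data.Product using (Σ; _×_)
open import Relation.Binary.PropositionalEquality using (_≡_)

-- A Young diagram is the list of its (positive, weakly decreasing) row lengths
-- [λ₁, λ₂, …]; this representation is canonical.
Diagram : Set
Diagram = List ℕ

ValidDiagram : Diagram → Set
ValidDiagram Y = Linked (λ a b → b ≤ a) Y × All (λ a → 1 ≤ a) Y

-- lam Y i = λ_i for i ≥ 1 (0 beyond the last row).  (lam Y 0 is never used
-- as a length; λ₀ = +∞ is handled by geLam below.)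
lam : Diagram → ℕ → ℕ
lam []      _             = 0
lam (a ∷ Y) zero          = 0
lam (a ∷ Y) (suc zero)    = a
lam (a ∷ Y) (suc (suc i)) = lam Y (suc i)

-- geLam Y i m  decides  λ_i ≥ m, with λ₀ = +∞.
geLam : Diagram → ℕ → ℕ → Bool
geLam Y zero    m = true
geLam Y (suc i) m = m ≤ᵇ lam Y (suc i)

-- h_Y(d) = min { h ≥ 1 : λ_{d-h} ≥ λ_d + h }, found by linear search over
-- h = 1, 2, …, d (h = d always qualifies since λ₀ = +∞).
hSearch : Diagram → ℕ → ℕ → ℕ → ℕ
hSearch Y d zero    h = h
hSearch Y d (suc k) h =
  if geLam Y (d ∸ h) (lam Y d + h) then h else hSearch Y d k (suc h)

hY : Diagram → ℕ → ℕ
hY Y d = hSearch Y d d 1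

-- Is row i among rows x - h_Y(x) + 1, …, x  (the rows of the B-strip of the
-- last box B of row x)?
inStrip : Diagram → ℕ → ℕ → Bool
inStrip Y x i = ((suc (x ∸ hY Y x)) ≤ᵇ i) ∧ (i ≤ᵇ x)

-- Y' ⋗ Y : Y' is Y with the B-strip of some corner box B deleted.
-- B is the last box of row x (x ≥ 1, row x nonempty), lowest in its column
-- (λ_{x+1} < λ_x); deleting the strip removes the last box of each strip row.
_⋗_ : Diagram → Diagram → Set
Y' ⋗ Y = Σ ℕ λ x →
    (1 ≤ x) × (1 ≤ lam Y x) × (lam Y (suc x) < lam Y x)
  × ((i : ℕ) → 1 ≤ i →
       lam Y' i ≡ (if inStrip Y x i then pred (lam Y i) else lam Y i))

SatChain : List Diagram → Set
SatChain ys = Σ (List Diagram) λ rest →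
  (ys ≡ [] ∷ rest) × All ValidDiagram ys × Linked _⋗_ ys

labelFrom : ℕ → List Diagram → ℕ → ℕ → ℕ
labelFrom r []       i j = 0
labelFrom r (Y ∷ ys) i j = if j ≤ᵇ lam Y i then r else labelFrom (suc r) ys i j

lastD : List Diagram → Diagram
lastD []           = []
lastD (Y ∷ [])     = Y
lastD (Y ∷ Z ∷ ys) = lastD (Z ∷ ys)

-- A tableau is the list of its rows of labels (row 1 first, entries left to right).
Tableau : Set
Tableau = List (List ℕ)

ψ : List Diagram → Tableau
ψ ys = applyUpTo (λ i → applyUpTo (λ j → labelFrom 0 ys (suc i) (suc j))
                                   (lam (lastD ys) (suc i)))
                 (length (lastD ys))

-- Walking along both chains from Y₀ = ∅: if Y_r = Y'_r,
-- the boxes of Y_{r+1} (resp. Y'_{r+1}) outside Y_r are exactly those labelled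
-- r + 1, so Y_{r+1} = Y'_{r+1}; and since every covering step adds at least one
-- box, one chain cannot stop while the other goes on.
module Submission where

open import Defs
open import Data.Bool using (true; false; T)
open import Data.Bool.Properties using (T-∧)
open import Data.Empty using (⊥-elim)
open import Data.List using (List; []; _∷_; map; length; applyUpTo)
open import Data.List.Properties using (length-applyUpTo; ∷-injective)
open import Data.List.Relation.Unary.All using (All; _∷_)
open import Data.List.Relation.Unary.Linked using (Linked; [-]; _∷_)
open import Data.Nat
  using (ℕ; zero; suc; _+_; _∸_; _≤_; _<_; _≤ᵇ_; _≤?_; pred; z≤n; s≤s)
open import Data.Nat.Properties
open import Data.Product using (Σ; _,_; proj₁; proj₂)
open import Data.Sum using (_⊎_; inj₁; inj₂; map₂)
open import Data.Unit using (tt)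
open import Function using (_∘_; Equivalence)
open import Relation.Binary.PropositionalEquality
open import Relation.Nullary using (¬_; yes; no)

open Equivalence using (from)

-- Rows and columns are shifted by one: i and j below stand for row suc i and
-- column suc j, so the box (i , j) lies in Y iff j < lam Y (suc i).
_⊑_ : Diagram → Diagram → Set
Y ⊑ Z = ∀ i → lam Y (suc i) ≤ lam Z (suc i)

≤-if-<-preserved : ∀ {a b} → (∀ j → j < a → j < b) → a ≤ b
≤-if-<-preserved {b = b} f = ≮⇒≥ λ b<a → n≮n b (f b b<a)

lam-injective : ∀ {Y Z} → All (1 ≤_) Y → All (1 ≤_) Z →
  (∀ i → lam Y (suc i) ≡ lam Z (suc i)) → Y ≡ Z
lam-injective {[]}    {[]}    _        _        _  = refl
lam-injective {[]}    {_ ∷ _} _        (pb ∷ _) eq = ⊥-elim (n≮n 0 (subst (1 ≤_) (sym (eq 0)) pb))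
lam-injective {_ ∷ _} {[]}    (pa ∷ _) _        eq = ⊥-elim (n≮n 0 (subst (1 ≤_) (eq 0) pa))
lam-injective {_ ∷ _} {_ ∷ _} (_ ∷ pY) (_ ∷ pZ) eq =
  cong₂ _∷_ (eq 0) (lam-injective pY pZ (eq ∘ suc))

lam-pos⇒<length : ∀ Y i → 0 < lam Y (suc i) → i < length Y
lam-pos⇒<length (_ ∷ _) zero    _   = s≤s z≤n
lam-pos⇒<length (_ ∷ Y) (suc i) pos = s≤s (lam-pos⇒<length Y i pos)

applyUpTo-lam : ∀ Y → applyUpTo (λ i → lam Y (suc i)) (length Y) ≡ Y
applyUpTo-lam []      = refl
applyUpTo-lam (a ∷ Y) = cong (a ∷_) (applyUpTo-lam Y)

map-length-applyUpTo : ∀ {A : Set} (g : ℕ → ℕ → A) (f : ℕ → ℕ) n →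
  map length (applyUpTo (λ i → applyUpTo (g i) (f i)) n) ≡ applyUpTo f n
map-length-applyUpTo g f zero    = refl
map-length-applyUpTo g f (suc n) =
  cong₂ _∷_ (length-applyUpTo (g 0) (f 0)) (map-length-applyUpTo (g ∘ suc) (f ∘ suc) n)

applyUpTo-≡⇒≗ : ∀ {A : Set} {f g : ℕ → A} {m n} → applyUpTo f m ≡ applyUpTo g n →
  ∀ {i} → i < m → f i ≡ g i
applyUpTo-≡⇒≗ {m = suc m} {suc n} eq {zero}  _         = proj₁ (∷-injective eq)
applyUpTo-≡⇒≗ {m = suc m} {suc n} eq {suc i} (s≤s i<m) =
  applyUpTo-≡⇒≗ (proj₂ (∷-injective eq)) i<m

hSearch-≥ : ∀ Y d k h → h ≤ hSearch Y d k h
hSearch-≥ Y d zero    h = ≤-refl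
hSearch-≥ Y d (suc k) h with geLam Y (d ∸ h) (lam Y d + h)
... | true  = ≤-refl
... | false = ≤-trans (n≤1+n h) (hSearch-≥ Y d k (suc h))

inStrip-self : ∀ Y x → T (inStrip Y (suc x) (suc x))
inStrip-self Y x = T-∧ .from
  ( ≤⇒≤ᵇ (s≤s (∸-monoʳ-≤ (suc x) (hSearch-≥ Y (suc x) (suc x) 1)))
  , ≤⇒≤ᵇ (≤-refl {suc x}) )

⋗⇒⊑ : ∀ {Y Z} → Y ⋗ Z → Y ⊑ Z
⋗⇒⊑ {Y} {Z} (x , _ , _ , _ , shape) i rewrite shape (suc i) (s≤s z≤n)
  with inStrip Z x (suc i)
... | true  = pred[n]≤n
... | false = ≤-refl

⋗⇒∃< : ∀ {Y Z} → Y ⋗ Z → Σ ℕ λ i → lam Y (suc i) < lam Z (suc i)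
⋗⇒∃< {Y} {Z} (suc x , _ , pos , _ , shape) = x , corner-removed
  where
  pred-< : ∀ {n} → 0 < n → pred n < n
  pred-< {suc n} _ = n<1+n n

  corner-removed : lam Y (suc x) < lam Z (suc x)
  corner-removed rewrite shape (suc x) (s≤s z≤n)
    with inStrip Z (suc x) (suc x) | inStrip-self Z x
  ... | true | _ = pred-< pos

⋗-chain⇒⊑-lastD : ∀ {Y zs} → Linked _⋗_ (Y ∷ zs) → Y ⊑ lastD (Y ∷ zs)
⋗-chain⇒⊑-lastD             [-]         i = ≤-refl
⋗-chain⇒⊑-lastD {Y} {Z ∷ _} (p ∷ chain) i =
  ≤-trans (⋗⇒⊑ {Y} {Z} p i) (⋗-chain⇒⊑-lastD chain i)

labelFrom-here : ∀ {s Y zs i j} → j ≤ lam Y i → labelFrom s (Y ∷ zs) i j ≡ s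
labelFrom-here {Y = Y} {i = i} {j} j≤λ with j ≤ᵇ lam Y i | ≤⇒≤ᵇ j≤λ
... | true | _ = refl

labelFrom-there : ∀ {s Y zs i j} → ¬ j ≤ lam Y i →
  labelFrom s (Y ∷ zs) i j ≡ labelFrom (suc s) zs i j
labelFrom-there {Y = Y} {i = i} {j} j≰λ with j ≤ᵇ lam Y i | ≤ᵇ⇒≤ j (lam Y i)
... | true  | j≤λ = ⊥-elim (j≰λ (j≤λ tt))
... | false | _   = refl

labelFrom-new : ∀ {s Y Z zs i j} → ¬ j ≤ lam Y i → j ≤ lam Z i →
  labelFrom s (Y ∷ Z ∷ zs) i j ≡ suc s
labelFrom-new {s} {Y} {Z} {zs} j∉Y j∈Z =
  trans (labelFrom-there {s} {Y} {Z ∷ zs} j∉Y) (labelFrom-here {suc s} {Z} {zs} j∈Z)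

labelFrom-≡0⊎≥ : ∀ s ys i j → labelFrom s ys i j ≡ 0 ⊎ s ≤ labelFrom s ys i j
labelFrom-≡0⊎≥ s []       i j = inj₁ refl
labelFrom-≡0⊎≥ s (Y ∷ ys) i j with j ≤? lam Y i
... | yes j≤λ = inj₂ (≤-reflexive (sym (labelFrom-here {s} {Y} {ys} j≤λ)))
... | no  j≰λ rewrite labelFrom-there {s} {Y} {ys} j≰λ =
  map₂ (≤-trans (n≤1+n s)) (labelFrom-≡0⊎≥ (suc s) ys i j)

labelFrom[2+s]≢1+s : ∀ s zs i j → labelFrom (suc (suc s)) zs i j ≢ suc s
labelFrom[2+s]≢1+s s zs i j eq with labelFrom-≡0⊎≥ (suc (suc s)) zs i j
... | inj₁ ≡0 = 0≢1+n (trans (sym ≡0) eq)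
... | inj₂ ≥  = n≮n (suc s) (≤-trans ≥ (≤-reflexive eq))

labelFrom-≡suc⇒here : ∀ {s Y zs i j} → labelFrom (suc s) (Y ∷ zs) i j ≡ suc s → j ≤ lam Y i
labelFrom-≡suc⇒here {s} {Y} {zs} {i} {j} eq with j ≤? lam Y i
... | yes j≤λ = j≤λ
... | no  j≰λ =
  ⊥-elim (labelFrom[2+s]≢1+s s zs i j (trans (sym (labelFrom-there {suc s} {Y} {zs} j≰λ)) eq))

labelFrom-outside : ∀ {s ys i j} → Linked _⋗_ ys → ¬ suc j ≤ lam (lastD ys) (suc i) →
  labelFrom s ys (suc i) (suc j) ≡ 0
labelFrom-outside {ys = []}         _ _   = refl
labelFrom-outside {s} {Y ∷ []}     _ out = labelFrom-there {s} {Y} {[]} out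
labelFrom-outside {s} {Y ∷ Z ∷ zs} {i} chain@(_ ∷ chain′) out =
  trans (labelFrom-there {s} {Y} {Z ∷ zs} (out ∘ λ j∈Y → ≤-trans j∈Y (⋗-chain⇒⊑-lastD chain i)))
        (labelFrom-outside chain′ out)

record SameLabels (r : ℕ) (ys ys′ : List Diagram) : Set where
  constructor sameLabels
  field
    at : ∀ i j → labelFrom r ys (suc i) (suc j) ≡ labelFrom r ys′ (suc i) (suc j)

open SameLabels

SameLabels-sym : ∀ {r ys ys′} → SameLabels r ys ys′ → SameLabels r ys′ ys
SameLabels-sym same = sameLabels λ i j → sym (same .at i j)

¬SameLabels-stop-step : ∀ {r Y Z zs} → Y ⋗ Z → ¬ SameLabels r (Y ∷ []) (Y ∷ Z ∷ zs)
¬SameLabels-stop-step {r} {Y} {Z} {zs} p same with ⋗⇒∃< {Y} {Z} p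
... | i , new = 0≢1+n (begin
  0                                               ≡⟨ sym (labelFrom-there {r} {Y} {[]} j∉Y) ⟩
  labelFrom r (Y ∷ []) (suc i) (suc j)            ≡⟨ same .at i j ⟩
  labelFrom r (Y ∷ Z ∷ zs) (suc i) (suc j)        ≡⟨ labelFrom-new {r} {Y} {Z} {zs} j∉Y new ⟩
  suc r                                           ∎)
  where
  open ≡-Reasoning
  j = lam Y (suc i)

  j∉Y : ¬ suc j ≤ lam Y (suc i)
  j∉Y = n≮n j

SameLabels⇒head-⊑ : ∀ {r Y Z Z′ zs zs′} → Y ⋗ Z′ →
  SameLabels r (Y ∷ Z ∷ zs) (Y ∷ Z′ ∷ zs′) → Z ⊑ Z′
SameLabels⇒head-⊑ {r} {Y} {Z} {Z′} {zs} {zs′} p′ same i = ≤-if-<-preserved box∈Z′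
  where
  box∈Z′ : ∀ j → j < lam Z (suc i) → j < lam Z′ (suc i)
  box∈Z′ j j∈Z with suc j ≤? lam Y (suc i)
  ... | yes j∈Y = ≤-trans j∈Y (⋗⇒⊑ {Y} {Z′} p′ i)
  ... | no  j∉Y = labelFrom-≡suc⇒here {r} {Z′} {zs′} (begin
    labelFrom (suc r) (Z′ ∷ zs′) (suc i) (suc j) ≡⟨ sym (labelFrom-there {r} {Y} {Z′ ∷ zs′} j∉Y) ⟩
    labelFrom r (Y ∷ Z′ ∷ zs′) (suc i) (suc j)   ≡⟨ sym (same .at i j) ⟩
    labelFrom r (Y ∷ Z ∷ zs) (suc i) (suc j)     ≡⟨ labelFrom-new {r} {Y} {Z} {zs} j∉Y j∈Z ⟩
    suc r                                        ∎)
    where open ≡-Reasoning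

SameLabels-tail : ∀ {r Y Z zs zs′} → Y ⋗ Z →
  SameLabels r (Y ∷ Z ∷ zs) (Y ∷ Z ∷ zs′) → SameLabels (suc r) (Z ∷ zs) (Z ∷ zs′)
SameLabels-tail {r} {Y} {Z} {zs} {zs′} p same = sameLabels tail-at
  where
  tail-at : ∀ i j →
    labelFrom (suc r) (Z ∷ zs) (suc i) (suc j) ≡ labelFrom (suc r) (Z ∷ zs′) (suc i) (suc j)
  tail-at i j with suc j ≤? lam Y (suc i)
  ... | yes j∈Y = trans (labelFrom-here {suc r} {Z} {zs} j∈Z)
                        (sym (labelFrom-here {suc r} {Z} {zs′} j∈Z))
    where
    j∈Z : suc j ≤ lam Z (suc i)
    j∈Z = ≤-trans j∈Y (⋗⇒⊑ {Y} {Z} p i)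
  ... | no  j∉Y = trans (sym (labelFrom-there {r} {Y} {Z ∷ zs} j∉Y))
                        (trans (same .at i j) (labelFrom-there {r} {Y} {Z ∷ zs′} j∉Y))

SameLabels⇒≡ : ∀ {r Y zs zs′} → Linked _⋗_ (Y ∷ zs) → Linked _⋗_ (Y ∷ zs′) →
  All ValidDiagram zs → All ValidDiagram zs′ → SameLabels r (Y ∷ zs) (Y ∷ zs′) → zs ≡ zs′
SameLabels⇒≡ {zs = []} {[]} _ _ _ _ _ = refl
SameLabels⇒≡ {Y = Y} {[]} {Z′ ∷ _} _ (p′ ∷ _) _ _ same =
  ⊥-elim (¬SameLabels-stop-step {Y = Y} {Z′} p′ same)
SameLabels⇒≡ {Y = Y} {Z ∷ _} {[]} (p ∷ _) _ _ _ same =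
  ⊥-elim (¬SameLabels-stop-step {Y = Y} {Z} p (SameLabels-sym same))
SameLabels⇒≡ {Y = Y} {Z ∷ _} {Z′ ∷ _} (p ∷ chain) (p′ ∷ chain′) (vZ ∷ vs) (vZ′ ∷ vs′) same
  with lam-injective (proj₂ vZ) (proj₂ vZ′) (λ i → ≤-antisym
         (SameLabels⇒head-⊑ {Y = Y} {Z′ = Z′} p′ same i)
         (SameLabels⇒head-⊑ {Y = Y} {Z′ = Z} p (SameLabels-sym same) i))
... | refl =
  cong (Z ∷_) (SameLabels⇒≡ chain chain′ vs vs′ (SameLabels-tail {Y = Y} {Z} p same))

map-length-ψ : ∀ ys → map length (ψ ys) ≡ lastD ys
map-length-ψ ys =
  trans (map-length-applyUpTo _ _ (length (lastD ys))) (applyUpTo-lam (lastD ys))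

ψ-≡⇒SameLabels : ∀ {ys ys′} → Linked _⋗_ ys → Linked _⋗_ ys′ →
  ψ ys ≡ ψ ys′ → SameLabels 0 ys ys′
ψ-≡⇒SameLabels {ys} {ys′} chain chain′ eq = sameLabels entries-≡
  where
  same-shape : lastD ys ≡ lastD ys′
  same-shape = trans (sym (map-length-ψ ys)) (trans (cong (map length) eq) (map-length-ψ ys′))

  entries-≡ : ∀ i j → labelFrom 0 ys (suc i) (suc j) ≡ labelFrom 0 ys′ (suc i) (suc j)
  entries-≡ i j with suc j ≤? lam (lastD ys) (suc i)
  ... | yes j∈L = applyUpTo-≡⇒≗ (applyUpTo-≡⇒≗ eq i∈L) j∈L
    where
    i∈L : i < length (lastD ys)
    i∈L = lam-pos⇒<length (lastD ys) i (≤-trans (s≤s z≤n) j∈L)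
  ... | no  j∉L = trans (labelFrom-outside chain j∉L) (sym (labelFrom-outside chain′ j∉L′))
    where
    j∉L′ : ¬ suc j ≤ lam (lastD ys′) (suc i)
    j∉L′ = j∉L ∘ subst (λ L → suc j ≤ lam L (suc i)) (sym same-shape)

proposition3p3 : (ys ys' : List Diagram) → SatChain ys → SatChain ys' →
    ψ ys ≡ ψ ys' → ys ≡ ys'
proposition3p3 _ _ (_ , refl , _ ∷ valid , chain) (_ , refl , _ ∷ valid′ , chain′) eq =
  cong ([] ∷_) (SameLabels⇒≡ chain chain′ valid valid′ (ψ-≡⇒SameLabels chain chain′ eq))
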